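{- Let $x_1,x_2,x_3,y_1,y_2,y_3$ be positive real numbers and set \begin{align*} X&=2x_1x_2+2x_1x_3+2x_2x_3-x_1^2-x_2^2-x_3^2,\\ Y&=2y_1y_2+2y_1y_3+2y_2y_3-y_1^2-y_2^2-y_3^2,\\ Z&=x_1(y_2+y_3-y_1)+x_2(y_1+y_3-y_2)+x_3(y_1+y_2-y_3). \end{align*} If $X,Y,Z$ are all nonnegative, then $XYZ<32\,x_1x_2x_3y_1y_2y_3$. -}

module Defs where

open import Level using (Level; suc; _⊔_)
open import Data.Nat using (ℕ; zero) renaming (suc to sucℕ)
open import Data.Product using (Σ; _×_; ∃)
open import Data.Sum using (_⊎_)
open import Relation.Nullary using (¬_)
open import Relation.Binary using (Rel; Trichotomous)
open import Algebra.Bundles using (CommutativeRing)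

-- The real numbers, axiomatised (up to isomorphism) as a complete ordered
-- field: a commutative ring with a strict total order compatible with the
-- ring operations, multiplicative inverses of nonzero elements, and the
-- least-upper-bound property.  (agda-stdlib has no real numbers.)
record RealField (c ℓ : Level) : Set (suc (c ⊔ ℓ)) where
  field
    commRing : CommutativeRing c ℓ
  open CommutativeRing commRing public
  infix 4 _<_ _≤_
  field
    _<_        : Rel Carrier ℓ
    <-resp-≈   : ∀ {a b a' b'} → a ≈ a' → b ≈ b' → a < b → a' < b'
    <-trans    : ∀ {a b d} → a < b → b < d → a < d
    <-tri      : Trichotomous _≈_ _<_
    +-mono-<   : ∀ {a b} d → a < b → a + d < b + d
    *-pos      : ∀ {a b} → 0# < a → 0# < b → 0# < a * b
    0<1        : 0# < 1#
    inverse    : ∀ a → ¬ (a ≈ 0#) → Σ Carrier (λ b → a * b ≈ 1#)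

  _≤_ : Rel Carrier ℓ
  a ≤ b = (a < b) ⊎ (a ≈ b)

  UpperBound : (Carrier → Set c) → Carrier → Set (c ⊔ ℓ)
  UpperBound P u = ∀ a → P a → a ≤ u

  field
    complete : (P : Carrier → Set c) → ∃ P → ∃ (UpperBound P) →
               Σ Carrier (λ s → UpperBound P s × (∀ u → UpperBound P u → s ≤ u))

  fromℕ : ℕ → Carrier
  fromℕ zero     = 0#
  fromℕ (sucℕ n) = 1# + fromℕ n

module _ {c ℓ} (R : RealField c ℓ) where
  open RealField R

  Q : Carrier → Carrier → Carrier → Carrier
  Q a b d = fromℕ 2 * a * b + fromℕ 2 * a * d + fromℕ 2 * b * d
            - a * a - b * b - d * d

  Zf : Carrier → Carrier → Carrier → Carrier → Carrier → Carrier → Carrier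
  Zf x₁ x₂ x₃ y₁ y₂ y₃ =
    x₁ * (y₂ + y₃ - y₁) + x₂ * (y₁ + y₃ - y₂) + x₃ * (y₁ + y₂ - y₃)

{-# OPTIONS --safe #-}

-- Let v₁ = x₂ + x₃ − x₁, v₂ = x₃ + x₁ − x₂, v₃ = x₁ + x₂ − x₃, define u₁, u₂, u₃ likewise from
-- the yᵢ, and put gᵢ = vᵢuᵢ. Then
--   32x₁x₂x₃y₁y₂y₃ − XYZ = 2(g₁²x₁y₁ + g₂²x₂y₂ + g₃²x₃y₃) − g₁g₂g₃.
-- Since X = 4x₁x₂ − v₃² and Y = 4y₁y₂ − u₃², the hypotheses X, Y ≥ 0 give g₃² ≤ 16x₁y₁x₂y₂, and
-- then AM–GM gives |g₁g₂g₃| ≤ 2(g₁²x₁y₁ + g₂²x₂y₂); cyclically for the other indices. As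
-- vᵢ + vⱼ = 2x_k > 0, at most one vᵢ and at most one uᵢ vanish, so some g_k is nonzero and the
-- remaining term 2g_k²x_ky_k makes the difference positive.

module Submission where

open import Defs
open import Data.Nat as ℕ using (zero; z≤n) renaming (suc to sucℕ)
open import Data.Nat.Properties using (+-suc)
open import Data.Integer as ℤ using (ℤ; +_; -[1+_]; +[1+_]; _⊖_)
open import Data.Integer.Properties using (⊖-≥; [1+m]⊖[1+n]≡m⊖n; pos-*; neg-distribˡ-*; neg-distribʳ-*)
open import Data.Maybe as Maybe using (Maybe)
open import Data.Sum using (_⊎_; inj₁; inj₂)
open import Data.Empty using (⊥-elim)
open import Function using (_∘_)
open import Relation.Nullary using (¬_)
open import Relation.Nullary.Decidable using (dec⇒maybe)
open import Relation.Binary using (tri<; tri≈; tri>)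
open import Relation.Binary.PropositionalEquality as ≡ using (cong)
open import Algebra.Bundles using (CommutativeRing)
open import Algebra.Solver.Ring.AlmostCommutativeRing using (fromCommutativeRing; _-Raw-AlmostCommutative⟶_)

module IntegerCoefficients {c ℓ} (R : CommutativeRing c ℓ) where
  open CommutativeRing R
  open import Algebra.Properties.Semiring.Mult semiring using (_×_; ×-homo-+; ×1-homo-*)
  open import Algebra.Properties.Ring ring using (-‿distribʳ-*; -‿distribˡ-*)
  open import Algebra.Properties.Group +-group using (ε⁻¹≈ε; ⁻¹-involutive)
  open import Algebra.Properties.AbelianGroup +-abelianGroup using (⁻¹-∙-comm)
  open import Algebra.Properties.CommutativeSemigroup +-commutativeSemigroup using (interchange)
  open import Relation.Binary.Reasoning.Setoid setoid

  fromℤ : ℤ → Carrier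
  fromℤ (+ n)    = n × 1#
  fromℤ -[1+ n ] = - (sucℕ n × 1#)

  [x+y]-[x+z]≈y-z : ∀ x y z → (x + y) - (x + z) ≈ y - z
  [x+y]-[x+z]≈y-z x y z = begin
    (x + y) - (x + z)       ≈⟨ +-congˡ (⁻¹-∙-comm x z) ⟨
    (x + y) + (- x + - z)   ≈⟨ interchange x y (- x) (- z) ⟩
    (x - x) + (y - z)       ≈⟨ +-congʳ (-‿inverseʳ x) ⟩
    0# + (y - z)            ≈⟨ +-identityˡ (y - z) ⟩
    y - z                   ∎

  ⊖-homo : ∀ m n → fromℤ (m ⊖ n) ≈ m × 1# - n × 1#
  ⊖-homo m        zero     = begin
    fromℤ (m ⊖ 0)   ≡⟨ cong fromℤ (⊖-≥ {m} z≤n) ⟩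
    m × 1#          ≈⟨ +-identityʳ (m × 1#) ⟨
    m × 1# + 0#     ≈⟨ +-congˡ ε⁻¹≈ε ⟨
    m × 1# - 0#     ∎
  ⊖-homo zero     (sucℕ n) = sym (+-identityˡ _)
  ⊖-homo (sucℕ m) (sucℕ n) = begin
    fromℤ (sucℕ m ⊖ sucℕ n)  ≡⟨ cong fromℤ ([1+m]⊖[1+n]≡m⊖n m n) ⟩
    fromℤ (m ⊖ n)            ≈⟨ ⊖-homo m n ⟩
    m × 1# - n × 1#          ≈⟨ [x+y]-[x+z]≈y-z 1# (m × 1#) (n × 1#) ⟨
    sucℕ m × 1# - sucℕ n × 1# ∎

  +-homo : ∀ i j → fromℤ (i ℤ.+ j) ≈ fromℤ i + fromℤ j
  +-homo (+ m)    (+ n)    = ×-homo-+ 1# m n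
  +-homo (+ m)    -[1+ n ] = ⊖-homo m (sucℕ n)
  +-homo -[1+ m ] (+ n)    = trans (⊖-homo n (sucℕ m)) (+-comm _ _)
  +-homo -[1+ m ] -[1+ n ] = begin
    - (sucℕ (sucℕ (m ℕ.+ n)) × 1#)  ≡⟨ cong (λ k → - (sucℕ k × 1#)) (+-suc m n) ⟨
    - ((sucℕ m ℕ.+ sucℕ n) × 1#)    ≈⟨ -‿cong (×-homo-+ 1# (sucℕ m) (sucℕ n)) ⟩
    - (sucℕ m × 1# + sucℕ n × 1#)          ≈⟨ ⁻¹-∙-comm _ _ ⟨
    - (sucℕ m × 1#) - sucℕ n × 1#          ∎

  -‿homo : ∀ i → fromℤ (ℤ.- i) ≈ - fromℤ i
  -‿homo (+ zero)  = sym ε⁻¹≈ε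
  -‿homo +[1+ n ]  = refl
  -‿homo -[1+ n ]  = sym (⁻¹-involutive _)

  *-homo-pos : ∀ m j → fromℤ (+ m ℤ.* j) ≈ m × 1# * fromℤ j
  *-homo-pos m (+ n)    = trans (reflexive (cong fromℤ (≡.sym (pos-* m n)))) (×1-homo-* m n)
  *-homo-pos m -[1+ n ] = begin
    fromℤ (+ m ℤ.* -[1+ n ])        ≡⟨ cong fromℤ (neg-distribʳ-* (+ m) +[1+ n ]) ⟨
    fromℤ (ℤ.- (+ m ℤ.* +[1+ n ]))  ≈⟨ -‿homo (+ m ℤ.* +[1+ n ]) ⟩
    - fromℤ (+ m ℤ.* +[1+ n ])      ≈⟨ -‿cong (*-homo-pos m +[1+ n ]) ⟩
    - (m × 1# * sucℕ n × 1#)        ≈⟨ -‿distribʳ-* _ _ ⟩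
    m × 1# * - (sucℕ n × 1#)        ∎

  *-homo : ∀ i j → fromℤ (i ℤ.* j) ≈ fromℤ i * fromℤ j
  *-homo (+ m)    j = *-homo-pos m j
  *-homo -[1+ m ] j = begin
    fromℤ (-[1+ m ] ℤ.* j)          ≡⟨ cong fromℤ (neg-distribˡ-* +[1+ m ] j) ⟨
    fromℤ (ℤ.- (+[1+ m ] ℤ.* j))    ≈⟨ -‿homo (+[1+ m ] ℤ.* j) ⟩
    - fromℤ (+[1+ m ] ℤ.* j)        ≈⟨ -‿cong (*-homo-pos (sucℕ m) j) ⟩
    - (sucℕ m × 1# * fromℤ j)       ≈⟨ -‿distribˡ-* _ _ ⟩
    - (sucℕ m × 1#) * fromℤ j       ∎

  fromℤ-homomorphism : ℤ.+-*-rawRing -Raw-AlmostCommutative⟶ fromCommutativeRing R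
  fromℤ-homomorphism = record
    { ⟦_⟧    = fromℤ
    ; +-homo = +-homo
    ; *-homo = *-homo
    ; -‿homo = -‿homo
    ; 0-homo = refl
    ; 1-homo = +-identityʳ 1#
    }

  fromℤ-≟ : ∀ i j → Maybe (fromℤ i ≈ fromℤ j)
  fromℤ-≟ i j = Maybe.map (reflexive ∘ cong fromℤ) (dec⇒maybe (i ℤ.≟ j))

  open import Algebra.Solver.Ring ℤ.+-*-rawRing (fromCommutativeRing R) fromℤ-homomorphism fromℤ-≟ public
    using (Polynomial; solve; _:=_; con; _:+_; _:*_; _:-_; :-_)

module RealFieldProperties {c ℓ} (R : RealField c ℓ) where
  open RealField R hiding (zero)
  open IntegerCoefficients commRing using (solve; _:=_; con; _:+_; _:*_; _:-_; :-_)

  <-irrefl : ∀ {a} → ¬ (a < a)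
  <-irrefl {a} a<a with <-tri a a
  ... | tri< _ _ a≯a = a≯a a<a
  ... | tri≈ a≮a _ _ = a≮a a<a
  ... | tri> a≮a _ _ = a≮a a<a

  ≤-<-trans : ∀ {a b d} → a ≤ b → b < d → a < d
  ≤-<-trans (inj₁ a<b) b<d = <-trans a<b b<d
  ≤-<-trans (inj₂ a≈b) b<d = <-resp-≈ (sym a≈b) refl b<d

  0<-resp-≈ : ∀ {a b} → a ≈ b → 0# < a → 0# < b
  0<-resp-≈ = <-resp-≈ refl

  0≤-resp-≈ : ∀ {a b} → a ≈ b → 0# ≤ a → 0# ≤ b
  0≤-resp-≈ a≈b (inj₁ 0<a) = inj₁ (0<-resp-≈ a≈b 0<a)
  0≤-resp-≈ a≈b (inj₂ 0≈a) = inj₂ (trans 0≈a a≈b)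

  x<y⇒0<y-x : ∀ {a b} → a < b → 0# < b - a
  x<y⇒0<y-x {a} a<b = <-resp-≈ (-‿inverseʳ a) refl (+-mono-< (- a) a<b)

  0<y-x⇒x<y : ∀ {a b} → 0# < b - a → a < b
  0<y-x⇒x<y {a} {b} 0<b-a =
    <-resp-≈ (+-identityˡ a) (solve 2 (λ a b → b :- a :+ a := b) refl a b) (+-mono-< a 0<b-a)

  +-pos-nonneg : ∀ {a b} → 0# < a → 0# ≤ b → 0# < a + b
  +-pos-nonneg {a} {b} 0<a (inj₁ 0<b) = <-trans (<-resp-≈ refl (sym (+-identityˡ b)) 0<b) (+-mono-< b 0<a)
  +-pos-nonneg {a} {b} 0<a (inj₂ 0≈b) = 0<-resp-≈ (trans (sym (+-identityʳ a)) (+-congˡ 0≈b)) 0<a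

  +-nonneg : ∀ {a b} → 0# ≤ a → 0# ≤ b → 0# ≤ a + b
  +-nonneg (inj₁ 0<a) 0≤b = inj₁ (+-pos-nonneg 0<a 0≤b)
  +-nonneg {a} {b} (inj₂ 0≈a) 0≤b = 0≤-resp-≈ (trans (sym (+-identityˡ b)) (+-congʳ 0≈a)) 0≤b

  *-nonneg : ∀ {a b} → 0# ≤ a → 0# ≤ b → 0# ≤ a * b
  *-nonneg         (inj₁ 0<a) (inj₁ 0<b) = inj₁ (*-pos 0<a 0<b)
  *-nonneg {a} {b} (inj₂ 0≈a) _          = inj₂ (trans (sym (zeroˡ b)) (*-congʳ 0≈a))
  *-nonneg {a} {b} (inj₁ _)   (inj₂ 0≈b) = inj₂ (trans (sym (zeroʳ a)) (*-congˡ 0≈b))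

  x≈0⊎0<x*x : ∀ a → a ≈ 0# ⊎ 0# < a * a
  x≈0⊎0<x*x a with <-tri a 0#
  ... | tri< a<0 _ _ = inj₂ (0<-resp-≈ (solve 1 (λ a → :- a :* :- a := a :* a) refl a) (*-pos 0<-a 0<-a))
    where 0<-a = 0<-resp-≈ (+-identityˡ (- a)) (x<y⇒0<y-x a<0)
  ... | tri≈ _ a≈0 _ = inj₁ a≈0
  ... | tri> _ _ 0<a = inj₂ (*-pos 0<a 0<a)

  x*x-nonneg : ∀ a → 0# ≤ a * a
  x*x-nonneg a with x≈0⊎0<x*x a
  ... | inj₁ a≈0   = inj₂ (sym (trans (*-congʳ a≈0) (zeroˡ a)))
  ... | inj₂ 0<a*a = inj₁ 0<a*a

  0<fromℕ-suc : ∀ n → 0# < fromℕ (sucℕ n)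
  0<fromℕ-suc zero     = +-pos-nonneg 0<1 (inj₂ refl)
  0<fromℕ-suc (sucℕ n) = +-pos-nonneg 0<1 (inj₁ (0<fromℕ-suc n))

  summand-nonzeroʳ : ∀ {a b} → 0# < a + b → a ≈ 0# → 0# < b * b
  summand-nonzeroʳ {a} {b} 0<a+b a≈0 = *-pos 0<b 0<b
    where 0<b = 0<-resp-≈ (trans (+-congʳ a≈0) (+-identityˡ b)) 0<a+b

  summand-nonzeroˡ : ∀ {a b} → 0# < a + b → b ≈ 0# → 0# < a * a
  summand-nonzeroˡ 0<a+b = summand-nonzeroʳ (0<-resp-≈ (+-comm _ _) 0<a+b)

  0≤y-x-from-squares : ∀ {a b} → 0# ≤ b → 0# ≤ b * b - a * a → 0# ≤ b - a
  0≤y-x-from-squares {a} {b} 0≤b 0≤b²-a² with <-tri a b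
  ... | tri< a<b _ _ = inj₁ (x<y⇒0<y-x a<b)
  ... | tri≈ _ a≈b _ = inj₂ (sym (trans (+-congʳ (sym a≈b)) (-‿inverseʳ a)))
  ... | tri> _ _ b<a = ⊥-elim (<-irrefl (0<-resp-≈ cancel (+-pos-nonneg 0<a²-b² 0≤b²-a²)))
    where
    0<a²-b² : 0# < a * a - b * b
    0<a²-b² = 0<-resp-≈ (solve 2 (λ a b → (a :- b) :* (a :+ b) := a :* a :- b :* b) refl a b)
                        (*-pos (x<y⇒0<y-x b<a) (+-pos-nonneg (≤-<-trans 0≤b b<a) 0≤b))
    cancel : (a * a - b * b) + (b * b - a * a) ≈ 0#
    cancel = solve 2 (λ a b → (a :* a :- b :* b) :+ (b :* b :- a :* a) := con (+ 0)) refl a b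

module Lemma2·3 {c ℓ} (R : RealField c ℓ) where
  open RealField R hiding (zero)
  open RealFieldProperties R
  open IntegerCoefficients commRing using (Polynomial; solve; _:=_; con; _:+_; _:*_; _:-_)
  open import Algebra.Properties.CommutativeSemigroup *-commutativeSemigroup using (interchange)
  open import Data.Product using (_×_; _,_)

  excess : Carrier → Carrier → Carrier → Carrier
  excess a b d = a + b - d

  gap : (x₁ x₂ x₃ y₁ y₂ y₃ : Carrier) → Carrier
  gap x₁ x₂ x₃ y₁ y₂ y₃ =
    fromℕ 32 * x₁ * x₂ * x₃ * y₁ * y₂ * y₃ - Q R x₁ x₂ x₃ * Q R y₁ y₂ y₃ * Zf R x₁ x₂ x₃ y₁ y₂ y₃

  -- The constant con (+ n) denotes n × 1#, which for each literal n is definitionally fromℕ n.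
  private
    :excess : ∀ {n} → Polynomial n → Polynomial n → Polynomial n → Polynomial n
    :excess a b d = a :+ b :- d

    :Q : ∀ {n} → Polynomial n → Polynomial n → Polynomial n → Polynomial n
    :Q a b d = con (+ 2) :* a :* b :+ con (+ 2) :* a :* d :+ con (+ 2) :* b :* d
               :- a :* a :- b :* b :- d :* d

    :gap : ∀ {n} → (x₁ x₂ x₃ y₁ y₂ y₃ : Polynomial n) → Polynomial n
    :gap x₁ x₂ x₃ y₁ y₂ y₃ =
      con (+ 32) :* x₁ :* x₂ :* x₃ :* y₁ :* y₂ :* y₃
      :- :Q x₁ x₂ x₃ :* :Q y₁ y₂ y₃
         :* (x₁ :* (y₂ :+ y₃ :- y₁) :+ x₂ :* (y₁ :+ y₃ :- y₂) :+ x₃ :* (y₁ :+ y₂ :- y₃))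

  Q-rotate : ∀ a b d → Q R a b d ≈ Q R b d a
  Q-rotate = solve 3 (λ a b d → :Q a b d := :Q b d a) refl

  gap-rotate : ∀ x₁ x₂ x₃ y₁ y₂ y₃ → gap x₁ x₂ x₃ y₁ y₂ y₃ ≈ gap x₂ x₃ x₁ y₂ y₃ y₁
  gap-rotate = solve 6 (λ x₁ x₂ x₃ y₁ y₂ y₃ → :gap x₁ x₂ x₃ y₁ y₂ y₃ := :gap x₂ x₃ x₁ y₂ y₃ y₁) refl

  gap-identity : ∀ x₁ x₂ x₃ y₁ y₂ y₃ →
    let g₁ = excess x₂ x₃ x₁ * excess y₂ y₃ y₁
        g₂ = excess x₃ x₁ x₂ * excess y₃ y₁ y₂
        g₃ = excess x₁ x₂ x₃ * excess y₁ y₂ y₃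
    in gap x₁ x₂ x₃ y₁ y₂ y₃
         ≈ fromℕ 2 * (g₁ * g₁ * (x₁ * y₁) + g₂ * g₂ * (x₂ * y₂) + g₃ * g₃ * (x₃ * y₃)) - g₁ * g₂ * g₃
  gap-identity = solve 6 (λ x₁ x₂ x₃ y₁ y₂ y₃ →
    let g₁ = :excess x₂ x₃ x₁ :* :excess y₂ y₃ y₁
        g₂ = :excess x₃ x₁ x₂ :* :excess y₃ y₁ y₂
        g₃ = :excess x₁ x₂ x₃ :* :excess y₁ y₂ y₃
    in :gap x₁ x₂ x₃ y₁ y₂ y₃
         := con (+ 2) :* (g₁ :* g₁ :* (x₁ :* y₁) :+ g₂ :* g₂ :* (x₂ :* y₂) :+ g₃ :* g₃ :* (x₃ :* y₃))
            :- g₁ :* g₂ :* g₃) refl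

  0<excess-sum : ∀ {a b d} → 0# < d → 0# < excess b d a + excess d a b
  0<excess-sum {a} {b} {d} 0<d =
    0<-resp-≈ (solve 3 (λ a b d → d :+ d := :excess b d a :+ :excess d a b) refl a b d)
              (+-pos-nonneg 0<d (inj₁ 0<d))

  -- With X = 4x₁x₂ − v² and Y = 4y₁y₂ − u² (v, u the excesses), 16x₁x₂y₁y₂ − (vu)² = X·4y₁y₂ + v²Y.
  excess-product-bound : ∀ {x₁ x₂ x₃ y₁ y₂ y₃} → 0# < y₁ → 0# < y₂ →
    0# ≤ Q R x₁ x₂ x₃ → 0# ≤ Q R y₁ y₂ y₃ →
    0# ≤ fromℕ 16 * (x₁ * y₁) * (x₂ * y₂)
         - (excess x₁ x₂ x₃ * excess y₁ y₂ y₃) * (excess x₁ x₂ x₃ * excess y₁ y₂ y₃)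
  excess-product-bound {x₁} {x₂} {x₃} {y₁} {y₂} {y₃} 0<y₁ 0<y₂ 0≤X 0≤Y =
    0≤-resp-≈ (solve 6 (λ x₁ x₂ x₃ y₁ y₂ y₃ →
                 :Q x₁ x₂ x₃ :* (con (+ 4) :* y₁ :* y₂) :+ :excess x₁ x₂ x₃ :* :excess x₁ x₂ x₃ :* :Q y₁ y₂ y₃
                 := con (+ 16) :* (x₁ :* y₁) :* (x₂ :* y₂)
                    :- (:excess x₁ x₂ x₃ :* :excess y₁ y₂ y₃) :* (:excess x₁ x₂ x₃ :* :excess y₁ y₂ y₃))
                refl x₁ x₂ x₃ y₁ y₂ y₃)
              (+-nonneg (*-nonneg 0≤X (inj₁ (*-pos (*-pos (0<fromℕ-suc 3) 0<y₁) 0<y₂)))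
                        (*-nonneg (x*x-nonneg (excess x₁ x₂ x₃)) 0≤Y))

  -- AM–GM, squared to avoid square roots: 2(g₁²s₁ + g₂²s₂) ≥ 4|g₁g₂|√(s₁s₂) ≥ |g₁g₂g₃|.
  cubic-term-bound : ∀ {g₁ g₂ g₃ s₁ s₂} → 0# ≤ s₁ → 0# ≤ s₂ → 0# ≤ fromℕ 16 * s₁ * s₂ - g₃ * g₃ →
    0# ≤ fromℕ 2 * (g₁ * g₁ * s₁ + g₂ * g₂ * s₂) - g₁ * g₂ * g₃
  cubic-term-bound {g₁} {g₂} {g₃} {s₁} {s₂} 0≤s₁ 0≤s₂ g₃²≤16s₁s₂ =
    0≤y-x-from-squares 0≤B
      (0≤-resp-≈ (solve 5 (λ g₁ g₂ g₃ s₁ s₂ →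
                    con (+ 4) :* ((g₁ :* g₁ :* s₁ :- g₂ :* g₂ :* s₂) :* (g₁ :* g₁ :* s₁ :- g₂ :* g₂ :* s₂))
                    :+ (g₁ :* g₂) :* (g₁ :* g₂) :* (con (+ 16) :* s₁ :* s₂ :- g₃ :* g₃)
                    := (con (+ 2) :* (g₁ :* g₁ :* s₁ :+ g₂ :* g₂ :* s₂))
                       :* (con (+ 2) :* (g₁ :* g₁ :* s₁ :+ g₂ :* g₂ :* s₂))
                       :- (g₁ :* g₂ :* g₃) :* (g₁ :* g₂ :* g₃))
                   refl g₁ g₂ g₃ s₁ s₂)
                 (+-nonneg (*-nonneg (inj₁ (0<fromℕ-suc 3)) (x*x-nonneg _))
                           (*-nonneg (x*x-nonneg (g₁ * g₂)) g₃²≤16s₁s₂)))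
    where
    0≤B : 0# ≤ fromℕ 2 * (g₁ * g₁ * s₁ + g₂ * g₂ * s₂)
    0≤B = *-nonneg (inj₁ (0<fromℕ-suc 1))
                   (+-nonneg (*-nonneg (x*x-nonneg g₁) 0≤s₁) (*-nonneg (x*x-nonneg g₂) 0≤s₂))

  cubic-form-pos : ∀ {g₁ g₂ g₃ s₁ s₂ s₃} → 0# ≤ s₁ → 0# ≤ s₂ → 0# ≤ fromℕ 16 * s₁ * s₂ - g₃ * g₃ →
    0# < g₃ * g₃ * s₃ →
    0# < fromℕ 2 * (g₁ * g₁ * s₁ + g₂ * g₂ * s₂ + g₃ * g₃ * s₃) - g₁ * g₂ * g₃
  cubic-form-pos {g₁} {g₂} {g₃} {s₁} {s₂} {s₃} 0≤s₁ 0≤s₂ g₃²≤16s₁s₂ 0<g₃²s₃ =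
    0<-resp-≈ (solve 6 (λ g₁ g₂ g₃ s₁ s₂ s₃ →
                 con (+ 2) :* (g₃ :* g₃ :* s₃) :+ (con (+ 2) :* (g₁ :* g₁ :* s₁ :+ g₂ :* g₂ :* s₂) :- g₁ :* g₂ :* g₃)
                 := con (+ 2) :* (g₁ :* g₁ :* s₁ :+ g₂ :* g₂ :* s₂ :+ g₃ :* g₃ :* s₃) :- g₁ :* g₂ :* g₃)
                refl g₁ g₂ g₃ s₁ s₂ s₃)
              (+-pos-nonneg (*-pos (0<fromℕ-suc 1) 0<g₃²s₃) (cubic-term-bound 0≤s₁ 0≤s₂ g₃²≤16s₁s₂))

  gap-pos₃ : ∀ {x₁ x₂ x₃ y₁ y₂ y₃} →
    0# < x₁ → 0# < x₂ → 0# < x₃ → 0# < y₁ → 0# < y₂ → 0# < y₃ →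
    0# ≤ Q R x₁ x₂ x₃ → 0# ≤ Q R y₁ y₂ y₃ →
    0# < excess x₁ x₂ x₃ * excess x₁ x₂ x₃ → 0# < excess y₁ y₂ y₃ * excess y₁ y₂ y₃ →
    0# < gap x₁ x₂ x₃ y₁ y₂ y₃
  gap-pos₃ {x₁} {x₂} {x₃} {y₁} {y₂} {y₃} 0<x₁ 0<x₂ 0<x₃ 0<y₁ 0<y₂ 0<y₃ 0≤X 0≤Y 0<v² 0<u² =
    0<-resp-≈ (sym (gap-identity x₁ x₂ x₃ y₁ y₂ y₃))
      (cubic-form-pos (inj₁ (*-pos 0<x₁ 0<y₁)) (inj₁ (*-pos 0<x₂ 0<y₂))
                      (excess-product-bound 0<y₁ 0<y₂ 0≤X 0≤Y)
                      (*-pos (0<-resp-≈ (interchange _ _ _ _) (*-pos 0<v² 0<u²)) (*-pos 0<x₃ 0<y₃)))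

  nonzero-in-common : ∀ {a₁ a₂ a₃ b₁ b₂ b₃} →
    0# < a₁ + a₂ → 0# < a₂ + a₃ → 0# < a₃ + a₁ →
    0# < b₁ + b₂ → 0# < b₂ + b₃ → 0# < b₃ + b₁ →
    (0# < a₁ * a₁ × 0# < b₁ * b₁) ⊎ (0# < a₂ * a₂ × 0# < b₂ * b₂) ⊎ (0# < a₃ * a₃ × 0# < b₃ * b₃)
  nonzero-in-common {a₁} {a₂} {a₃} {b₁} {b₂} {b₃} a₁₂ a₂₃ a₃₁ b₁₂ b₂₃ b₃₁
    with x≈0⊎0<x*x a₁ | x≈0⊎0<x*x b₁ | x≈0⊎0<x*x a₂ | x≈0⊎0<x*x b₂
  ... | inj₂ a₁≠0 | inj₂ b₁≠0 | _         | _         = inj₁ (a₁≠0 , b₁≠0)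
  ... | inj₁ a₁≈0 | _         | _         | inj₂ b₂≠0 = inj₂ (inj₁ (summand-nonzeroʳ a₁₂ a₁≈0 , b₂≠0))
  ... | inj₁ a₁≈0 | _         | _         | inj₁ b₂≈0 =
    inj₂ (inj₂ (summand-nonzeroˡ a₃₁ a₁≈0 , summand-nonzeroʳ b₂₃ b₂≈0))
  ... | inj₂ _    | inj₁ b₁≈0 | inj₂ a₂≠0 | _         = inj₂ (inj₁ (a₂≠0 , summand-nonzeroʳ b₁₂ b₁≈0))
  ... | inj₂ _    | inj₁ b₁≈0 | inj₁ a₂≈0 | _         =
    inj₂ (inj₂ (summand-nonzeroʳ a₂₃ a₂≈0 , summand-nonzeroˡ b₃₁ b₁≈0))

  gap-pos : ∀ {x₁ x₂ x₃ y₁ y₂ y₃} →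
    0# < x₁ → 0# < x₂ → 0# < x₃ → 0# < y₁ → 0# < y₂ → 0# < y₃ →
    0# ≤ Q R x₁ x₂ x₃ → 0# ≤ Q R y₁ y₂ y₃ → 0# < gap x₁ x₂ x₃ y₁ y₂ y₃
  gap-pos {x₁} {x₂} {x₃} {y₁} {y₂} {y₃} 0<x₁ 0<x₂ 0<x₃ 0<y₁ 0<y₂ 0<y₃ 0≤X 0≤Y
    with nonzero-in-common (0<excess-sum 0<x₃) (0<excess-sum 0<x₁) (0<excess-sum 0<x₂)
                           (0<excess-sum 0<y₃) (0<excess-sum 0<y₁) (0<excess-sum 0<y₂)
  ... | inj₁ (0<v₁² , 0<u₁²) =
    0<-resp-≈ (sym (gap-rotate x₁ x₂ x₃ y₁ y₂ y₃))
      (gap-pos₃ 0<x₂ 0<x₃ 0<x₁ 0<y₂ 0<y₃ 0<y₁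
                (0≤-resp-≈ (Q-rotate x₁ x₂ x₃) 0≤X) (0≤-resp-≈ (Q-rotate y₁ y₂ y₃) 0≤Y) 0<v₁² 0<u₁²)
  ... | inj₂ (inj₁ (0<v₂² , 0<u₂²)) =
    0<-resp-≈ (gap-rotate x₃ x₁ x₂ y₃ y₁ y₂)
      (gap-pos₃ 0<x₃ 0<x₁ 0<x₂ 0<y₃ 0<y₁ 0<y₂
                (0≤-resp-≈ (sym (Q-rotate x₃ x₁ x₂)) 0≤X) (0≤-resp-≈ (sym (Q-rotate y₃ y₁ y₂)) 0≤Y) 0<v₂² 0<u₂²)
  ... | inj₂ (inj₂ (0<v₃² , 0<u₃²)) = gap-pos₃ 0<x₁ 0<x₂ 0<x₃ 0<y₁ 0<y₂ 0<y₃ 0≤X 0≤Y 0<v₃² 0<u₃²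

lemma2p3 : ∀ {c ℓ} (R : RealField c ℓ) → let open RealField R in
    ∀ x₁ x₂ x₃ y₁ y₂ y₃ →
    0# < x₁ → 0# < x₂ → 0# < x₃ → 0# < y₁ → 0# < y₂ → 0# < y₃ →
    0# ≤ Q R x₁ x₂ x₃ → 0# ≤ Q R y₁ y₂ y₃ → 0# ≤ Zf R x₁ x₂ x₃ y₁ y₂ y₃ →
    Q R x₁ x₂ x₃ * Q R y₁ y₂ y₃ * Zf R x₁ x₂ x₃ y₁ y₂ y₃
      < fromℕ 32 * x₁ * x₂ * x₃ * y₁ * y₂ * y₃
lemma2p3 R _ _ _ _ _ _ 0<x₁ 0<x₂ 0<x₃ 0<y₁ 0<y₂ 0<y₃ 0≤X 0≤Y _ =
  0<y-x⇒x<y (gap-pos 0<x₁ 0<x₂ 0<x₃ 0<y₁ 0<y₂ 0<y₃ 0≤X 0≤Y)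
  where
  open RealFieldProperties R
  open Lemma2·3 R
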